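{- Let the diamond graph be the graph on vertices $d_1,d_2,d_3,d_4$ with edges $d_1d_2$, $d_1d_3$, $d_2d_3$, $d_2d_4$, $d_3d_4$ (i.e. $K_4$ minus the edge $d_1d_4$). Let $H$ be the $(d_2,2)$-ordering of the diamond graph. Then $R_<(H)\le 17$.
   Context: A $k$-ordering of a graph $H$ assigns distinct order-labels from $\{1,\ldots,|H|\}$ to $k$ of the vertices of $H$. For a vertex $v$ of $H$ and $1\le l\le |H|$, the $(v,l)$-ordering of $H$ is the 1-ordering in which $v$ receives order-label $l$ and no other vertex is labeled. An ordered 2-coloring on $n$ vertices is a red/blue coloring of the edges of the complete graph on vertex set $\{1,\ldots,n\}$. It contains a $k$-ordering $H$ (in a given color) if it has a subgraph isomorphic to $H$, all of whose edges have that color, such that for every $i$ the $i$-th smallest vertex of the copy corresponds to a vertex of $H$ that has order-label $i$ or no order-label. $R_<(H)$ is the least $n$ such that every ordered 2-coloring on $n$ vertices contains a monochromatic (red or blue) copy of $H$. -}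

module Defs where

open import Data.Nat using (ℕ; suc; _≤_)
open import Data.Fin using (Fin; toℕ; _<_; _<?_) renaming (zero to f0; suc to fs)
open import Data.Fin.Properties using ()
open import Data.Product using (Σ; ∃; _×_; _,_)
open import Data.List using (List; _∷_; []; filter; length)
open import Data.List.Membership.Propositional using (_∈_)
open import Data.Maybe using (Maybe; just; nothing)
open import Data.Vec.Functional using ()
open import Function.Definitions using (Injective)
open import Relation.Binary.PropositionalEquality using (_≡_)
open import Relation.Nullary using (yes; no)
open import Data.Fin using (_≟_)
open import Data.List using (allFin) public

data Colour : Set where
  red blue : Colour

-- An ordered 2-colouring on vertex set {1,…,n} (represented by Fin n with its
-- natural order).  χ i j is consulted only for i < j: the colour of edge {i,j}
-- is χ (min i j) (max i j).
Colouring : ℕ → Set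
Colouring n = Fin n → Fin n → Colour

edgeColour : ∀ {n} → Colouring n → Fin n → Fin n → Colour
edgeColour χ i j with i <? j
... | yes _ = χ i j
... | no  _ = χ j i

-- A graph with k-ordering: m vertices (Fin m), a list of edges, and a partial
-- labelling assigning order-labels.  A label l : Fin m denotes order-label
-- toℕ l + 1 ∈ {1,…,m}.
record OrderedGraph : Set where
  field
    size   : ℕ
    edges  : List (Fin size × Fin size)
    label  : Fin size → Maybe (Fin size)
open OrderedGraph public

rankBelow : ∀ {m n} → (Fin m → Fin n) → Fin m → ℕ
rankBelow {m} f v = length (filter (λ u → f u <? f v) (allFin m))

Contains : ∀ {n} → Colouring n → Colour → OrderedGraph → Set
Contains {n} χ c H =
  Σ (Fin (size H) → Fin n) λ f →
    Injective _≡_ _≡_ f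
    × (∀ {a b} → (a , b) ∈ edges H → edgeColour χ (f a) (f b) ≡ c)
    × (∀ v l → label H v ≡ just l → rankBelow f v ≡ toℕ l)

Monochromatic : ∀ {n} → Colouring n → OrderedGraph → Set
Monochromatic χ H = Σ Colour λ c → Contains χ c H

Arrows : ℕ → OrderedGraph → Set
Arrows n H = (χ : Colouring n) → Monochromatic χ H

-- R_<(H) ≤ N  ⇔  the least n with Arrows n H is at most N
--              ⇔  some n ≤ N has Arrows n H.
OrderedRamseyLE : OrderedGraph → ℕ → Set
OrderedRamseyLE H N = Σ ℕ λ n → n ≤ N × Arrows n H

d1 d2 d3 d4 : Fin 4
d1 = f0
d2 = fs f0
d3 = fs (fs f0)
d4 = fs (fs (fs f0))

diamondEdges : List (Fin 4 × Fin 4)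
diamondEdges = (d1 , d2) ∷ (d1 , d3) ∷ (d2 , d3) ∷ (d2 , d4) ∷ (d3 , d4) ∷ []

d2label : Fin 4 → Maybe (Fin 4)
d2label v with v ≟ d2
... | yes _ = just (fs f0)
... | no  _ = nothing

diamond-d2-2 : OrderedGraph
diamond-d2-2 = record { size = 4 ; edges = diamondEdges ; label = d2label }

-- Let a be the least of 12 vertices. Six of the eleven vertices above a are
-- joined to a in one colour c; let r be the least of them and T the other five.
-- If two vertices y < z of T are joined to r in colour c, then a < r < y < z
-- carries a diamond of colour c with d₂ ↦ r (every edge but yz is present).
-- Otherwise four vertices s < y₁ < y₂ < y₃ of T are joined to r in the other
-- colour c′; two of the edges syᵢ share a colour, and with a (if it is c) or
-- r (if it is c′) they give a diamond with d₂ ↦ s. So in fact R_<(H) ≤ 12.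
module Submission where

open import Defs
open import Data.Nat using (suc; _+_; _<_; _≤_; _<?_; s≤s)
open import Data.Nat.Properties using (+-suc; +-mono-≤; ≮⇒≥; <⇒≱; m≤m+n; ≤-refl; module ≤-Reasoning)
open import Data.Fin as Fin using (Fin)
open import Data.Fin.Properties as Fin using (<⇒≢)
open import Data.Product using (_,_)
open import Data.Sum using (_⊎_; inj₁; inj₂)
open import Data.List using (List; []; _∷_; length; filter)
open import Data.List.Properties using (filter-accept; filter-reject; length-tabulate)
open import Data.List.Relation.Unary.All as All using (All; []; _∷_)
open import Data.List.Relation.Unary.All.Properties as All using (all-filter)
open import Data.List.Relation.Unary.AllPairs as AllPairs using (AllPairs; []; _∷_)
open import Data.List.Relation.Unary.AllPairs.Properties as AllPairs using ()
open import Data.List.Relation.Unary.Any using (here; there)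
open import Data.List.Membership.Propositional using (_∈_)
open import Data.Vec using ([]; _∷_; lookup)
open import Data.Vec.Relation.Unary.All using ([]; _∷_)
open import Data.Vec.Relation.Unary.AllPairs using ([]; _∷_)
open import Data.Vec.Relation.Unary.Unique.Propositional using (Unique)
open import Data.Vec.Relation.Unary.Unique.Propositional.Properties using (lookup-injective)
open import Data.Maybe using (just)
open import Data.Empty using (⊥-elim)
open import Function using (id)
open import Relation.Binary.PropositionalEquality using (_≡_; refl; ≢-sym; sym; trans; cong; subst; module ≡-Reasoning)
open import Relation.Nullary using (Dec; yes; no)

opposite : Colour → Colour
opposite red  = blue
opposite blue = red

_≟ᶜ_ : (c d : Colour) → Dec (c ≡ d)
red  ≟ᶜ red  = yes refl
red  ≟ᶜ blue = no λ ()
blue ≟ᶜ red  = no λ ()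
blue ≟ᶜ blue = yes refl

withColour : ∀ {n} → (Fin n → Colour) → Colour → List (Fin n) → List (Fin n)
withColour g c = filter (λ v → g v ≟ᶜ c)

length-withColour : ∀ {n} (g : Fin n → Colour) c xs →
  length (withColour g c xs) + length (withColour g (opposite c) xs) ≡ length xs
length-withColour g c    []       = refl
length-withColour g red  (v ∷ vs) with g v | length-withColour g red vs
... | red  | ih = cong suc ih
... | blue | ih = trans (+-suc _ _) (cong suc ih)
length-withColour g blue (v ∷ vs) with g v | length-withColour g blue vs
... | red  | ih = trans (+-suc _ _) (cong suc ih)
... | blue | ih = cong suc ih

pigeonhole : ∀ {n} (g : Fin n → Colour) c {m k} xs → m + k < length xs →
  m < length (withColour g c xs) ⊎ k < length (withColour g (opposite c) xs)
pigeonhole g c {m} {k} xs m+k<∣xs∣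
  with m <? length (withColour g c xs) | k <? length (withColour g (opposite c) xs)
... | yes m<∣c∣ | _          = inj₁ m<∣c∣
... | no  _     | yes k<∣c′∣ = inj₂ k<∣c′∣
... | no  m≮∣c∣ | no  k≮∣c′∣ = ⊥-elim (<⇒≱ m+k<∣xs∣ ∣xs∣≤m+k)
  where
  open ≤-Reasoning
  ∣xs∣≤m+k : length xs ≤ m + k
  ∣xs∣≤m+k = begin
    length xs                                                          ≡⟨ sym (length-withColour g c xs) ⟩
    length (withColour g c xs) + length (withColour g (opposite c) xs) ≤⟨ +-mono-≤ (≮⇒≥ m≮∣c∣) (≮⇒≥ k≮∣c′∣) ⟩
    m + k                                                              ∎

Increasing : ∀ {n} → List (Fin n) → Set
Increasing = AllPairs Fin._<_

increasing-withColour : ∀ {n} {x : Fin n} {ys} g c →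
  Increasing (x ∷ ys) → Increasing (x ∷ withColour g c ys)
increasing-withColour g c (x<ys ∷ ys↑) = All.filter⁺ _ x<ys ∷ AllPairs.filter⁺ _ ys↑

module _ {n} (χ : Colouring n) where

  Joined : Colour → Fin n → List (Fin n) → Set
  Joined c a = All (λ v → χ a v ≡ c)

  edgeColour-< : ∀ {i j} → i Fin.< j → edgeColour χ i j ≡ χ i j
  edgeColour-< {i} {j} i<j with i Fin.<? j
  ... | yes _   = refl
  ... | no  i≮j = ⊥-elim (i≮j i<j)

  edgeColour-> : ∀ {i j} → i Fin.< j → edgeColour χ j i ≡ χ i j
  edgeColour-> {i} {j} i<j with j Fin.<? i
  ... | yes j<i = ⊥-elim (Fin.<-asym i<j j<i)
  ... | no  _   = refl

  diamond : ∀ c {a x y z} → a Fin.< x → x Fin.< y → y Fin.< z →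
    Joined c a (x ∷ y ∷ z ∷ []) → Joined c x (y ∷ z ∷ []) → Monochromatic χ diamond-d2-2
  diamond c {a} {x} {y} {z} a<x x<y y<z (ax ∷ ay ∷ az ∷ []) (xy ∷ xz ∷ []) =
    c , f , injective , monochromatic , ranked
    where
    a<y = Fin.<-trans a<x x<y
    x<z = Fin.<-trans x<y y<z
    a<z = Fin.<-trans a<y y<z

    -- The non-edge d₁d₄ goes to yz, and d₂ to the second smallest vertex x.
    f : Fin 4 → Fin n
    f = lookup (y ∷ x ∷ a ∷ z ∷ [])

    injective : ∀ {u v} → f u ≡ f v → u ≡ v
    injective = lookup-injective distinct _ _
      where
      distinct : Unique (y ∷ x ∷ a ∷ z ∷ [])
      distinct = (≢-sym (<⇒≢ x<y) ∷ ≢-sym (<⇒≢ a<y) ∷ <⇒≢ y<z ∷ [])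
               ∷ (≢-sym (<⇒≢ a<x) ∷ <⇒≢ x<z ∷ [])
               ∷ (<⇒≢ a<z ∷ [])
               ∷ [] ∷ []

    monochromatic : ∀ {u v} → (u , v) ∈ diamondEdges → edgeColour χ (f u) (f v) ≡ c
    monochromatic (here refl)                                 = trans (edgeColour-> x<y) xy
    monochromatic (there (here refl))                         = trans (edgeColour-> a<y) ay
    monochromatic (there (there (here refl)))                 = trans (edgeColour-> a<x) ax
    monochromatic (there (there (there (here refl))))         = trans (edgeColour-< x<z) xz
    monochromatic (there (there (there (there (here refl))))) = trans (edgeColour-< a<z) az

    below : ∀ u → Dec (f u Fin.< x)
    below u = f u Fin.<? x

    rank-x : rankBelow f d2 ≡ 1
    rank-x = cong length (begin
      filter below (d1 ∷ d2 ∷ d3 ∷ d4 ∷ []) ≡⟨ filter-reject below (Fin.<-asym x<y) ⟩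
      filter below (d2 ∷ d3 ∷ d4 ∷ [])      ≡⟨ filter-reject below (Fin.<-irrefl refl) ⟩
      filter below (d3 ∷ d4 ∷ [])           ≡⟨ filter-accept below a<x ⟩
      d3 ∷ filter below (d4 ∷ [])           ≡⟨ cong (d3 ∷_) (filter-reject below (Fin.<-asym x<z)) ⟩
      d3 ∷ []                               ∎)
      where open ≡-Reasoning

    ranked : ∀ v l → label diamond-d2-2 v ≡ just l → rankBelow f v ≡ Fin.toℕ l
    ranked (Fin.suc Fin.zero) _ refl = rank-x

  diamond-from-common-neighbourhood : ∀ c {a x ys} → a Fin.< x → Increasing (x ∷ ys) →
    Joined c a (x ∷ ys) → Joined c x ys → 2 ≤ length ys → Monochromatic χ diamond-d2-2
  diamond-from-common-neighbourhood c {ys = []}    _ _ _ _ ()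
  diamond-from-common-neighbourhood c {ys = _ ∷ []} _ _ _ _ (s≤s ())
  diamond-from-common-neighbourhood c a<x ((x<y ∷ _) ∷ (y<z ∷ _) ∷ _) (ax ∷ ay ∷ az ∷ _) (xy ∷ xz ∷ _) _ =
    diamond c a<x x<y y<z (ax ∷ ay ∷ az ∷ []) (xy ∷ xz ∷ [])

  diamond-from-opposite-neighbourhoods : ∀ c {a r ys} → a Fin.< r → Increasing (r ∷ ys) →
    Joined c a ys → Joined (opposite c) r ys → 4 ≤ length ys → Monochromatic χ diamond-d2-2
  diamond-from-opposite-neighbourhoods c {ys = []} _ _ _ _ ()
  diamond-from-opposite-neighbourhoods c {ys = s ∷ ys}
    a<r ((r<s ∷ _) ∷ s↑ys) (as ∷ a-ys) (rs ∷ r-ys) (s≤s 3≤∣ys∣)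
    with pigeonhole (χ s) c {1} {1} ys 3≤∣ys∣
  ... | inj₁ 2≤∣c∣  = diamond-from-common-neighbourhood c (Fin.<-trans a<r r<s)
                        (increasing-withColour (χ s) c s↑ys) (as ∷ All.filter⁺ _ a-ys) (all-filter _ ys) 2≤∣c∣
  ... | inj₂ 2≤∣c′∣ = diamond-from-common-neighbourhood (opposite c) r<s
                        (increasing-withColour (χ s) (opposite c) s↑ys) (rs ∷ All.filter⁺ _ r-ys) (all-filter _ ys) 2≤∣c′∣

  diamond-from-monochromatic-neighbourhood : ∀ c {a ys} → Increasing (a ∷ ys) → Joined c a ys →
    6 ≤ length ys → Monochromatic χ diamond-d2-2
  diamond-from-monochromatic-neighbourhood c {ys = []} _ _ ()
  diamond-from-monochromatic-neighbourhood c {ys = r ∷ ys} ((a<r ∷ _) ∷ r↑ys) (ar ∷ a-ys) (s≤s 5≤∣ys∣)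
    with pigeonhole (χ r) c {1} {3} ys 5≤∣ys∣
  ... | inj₁ 2≤∣c∣  = diamond-from-common-neighbourhood c a<r
                        (increasing-withColour (χ r) c r↑ys) (ar ∷ All.filter⁺ _ a-ys) (all-filter _ ys) 2≤∣c∣
  ... | inj₂ 4≤∣c′∣ = diamond-from-opposite-neighbourhoods c a<r
                        (increasing-withColour (χ r) (opposite c) r↑ys) (All.filter⁺ _ a-ys) (all-filter _ ys) 4≤∣c′∣

  diamond-from-increasing : ∀ {a ys} → Increasing (a ∷ ys) → 11 ≤ length ys → Monochromatic χ diamond-d2-2
  diamond-from-increasing {a} {ys} a↑ys 11≤∣ys∣ with pigeonhole (χ a) red {5} {5} ys 11≤∣ys∣
  ... | inj₁ 6≤∣red∣  = diamond-from-monochromatic-neighbourhood red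
                          (increasing-withColour (χ a) red a↑ys) (all-filter _ ys) 6≤∣red∣
  ... | inj₂ 6≤∣blue∣ = diamond-from-monochromatic-neighbourhood blue
                          (increasing-withColour (χ a) blue a↑ys) (all-filter _ ys) 6≤∣blue∣

arrows-diamond : ∀ {n} → 12 ≤ n → Arrows n diamond-d2-2
arrows-diamond {suc n} (s≤s 11≤n) χ =
  diamond-from-increasing χ (AllPairs.tabulate⁺-< id) (subst (11 ≤_) (sym (length-tabulate Fin.suc)) 11≤n)

theorem3p10 : OrderedRamseyLE diamond-d2-2 17
theorem3p10 = 12 , m≤m+n 12 5 , arrows-diamond ≤-refl
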